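{- For every integer $n\ge1$ and every $\alpha\in[0,1)$, the following identities of polynomials in $\lambda$ hold: (i) $\phi(P_{n+1})=(\lambda-2\alpha)\phi(P_n)-(1-\alpha)^2\phi(P_{n-1})$; (ii) $\phi(P_{n+1})=\lambda\,\phi(H_n)+(2\alpha-1)\phi(H_{n-1})$; (iii) $\phi(C_{n+2})=(\lambda-2\alpha)\phi(H_{n+1})-2(\alpha-1)^2\phi(H_n)+2(-1)^{n+1}(\alpha-1)^{n+2}$.
   Context: For a graph $G$ with degree matrix $D(G)$ and adjacency matrix $A(G)$, and $\alpha\in[0,1]$, let $A_\alpha(G)=\alpha D(G)+(1-\alpha)A(G)$. For a graph $G$ let $\phi(G)=\det(\lambda I-A_\alpha(G))$, and for a square matrix $M$ let $\phi(M)=\det(\lambda I-M)$. $P_m$ is the path on $m$ vertices $u_1,\dots,u_m$ (in order) and $C_m$ the cycle on $m$ vertices. For $n\ge1$, $H_n$ is the $n\times n$ principal submatrix of $A_\alpha(P_{n+2})$ obtained by deleting the rows and columns of both end vertices $u_1,u_{n+2}$. By convention, for $\alpha\in[0,1)$, $\phi(P_0)=\frac{1-2\alpha}{(1-\alpha)^2}$ and $\phi(H_0)=1$. -}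

module Defs where

open import Level using (Level)
open import Algebra.Bundles using (CommutativeRing)
open import Data.Nat as ℕ using (ℕ; zero; suc)
open import Data.Fin using (Fin; zero; suc; toℕ; punchIn; inject₁)
open import Data.Bool using (Bool; true; false; if_then_else_; _∨_; _∧_)
open import Data.Fin using (_≟_)
open import Relation.Nullary.Decidable using (⌊_⌋)

Graph : ℕ → Set
Graph m = Fin m → Fin m → Bool

-- The path P_m on vertices u_1,…,u_m; vertex u_{k+1} is (the Fin m element) k.
-- u_i ~ u_j iff |i - j| = 1.
pathAdj : (m : ℕ) → Graph m
pathAdj m i j = (toℕ i ℕ.≡ᵇ suc (toℕ j)) ∨ (toℕ j ℕ.≡ᵇ suc (toℕ i))

-- The cycle C_m (intended for m ≥ 3): the path plus the edge between the two ends.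
cycleAdj : (m : ℕ) → Graph m
cycleAdj m i j =
  pathAdj m i j
  ∨ ((toℕ i ℕ.≡ᵇ 0) ∧ (toℕ j ℕ.≡ᵇ (m ℕ.∸ 1)))
  ∨ ((toℕ j ℕ.≡ᵇ 0) ∧ (toℕ i ℕ.≡ᵇ (m ℕ.∸ 1)))

countFin : (m : ℕ) → (Fin m → Bool) → ℕ
countFin zero    p = 0
countFin (suc m) p = (if p zero then 1 else 0) ℕ.+ countFin m (λ k → p (suc k))

degree : {m : ℕ} → Graph m → Fin m → ℕ
degree {m} G i = countFin m (G i)

module AlphaMatrices {c ℓ : Level} (R : CommutativeRing c ℓ) where
  open CommutativeRing R using (Carrier; _+_; _*_; -_; 0#; 1#; _-_)

  Mat : ℕ → Set c
  Mat n = Fin n → Fin n → Carrier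

  fromℕ : ℕ → Carrier
  fromℕ zero    = 0#
  fromℕ (suc n) = 1# + fromℕ n

  pow : Carrier → ℕ → Carrier
  pow x zero    = 1#
  pow x (suc n) = x * pow x n

  sgn : ℕ → Carrier
  sgn k = pow (- 1#) k

  sumFin : (n : ℕ) → (Fin n → Carrier) → Carrier
  sumFin zero    f = 0#
  sumFin (suc n) f = f zero + sumFin n (λ k → f (suc k))

  det : (n : ℕ) → Mat n → Carrier
  det zero    M = 1#
  det (suc n) M =
    sumFin (suc n) (λ j → sgn (toℕ j) * (M zero j * det n (λ i k → M (suc i) (punchIn j k))))

  -- characteristic polynomial evaluated at λ:  φ(M) = det(λ I - M)
  charPoly : (n : ℕ) → Mat n → Carrier → Carrier
  charPoly n M x = det n (λ i j → (if ⌊ i ≟ j ⌋ then x else 0#) - M i j)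

  Aα : Carrier → {m : ℕ} → Graph m → Mat m
  Aα a {m} G i j =
    a * (if ⌊ i ≟ j ⌋ then fromℕ (degree G i) else 0#)
    + (1# - a) * (if G i j then 1# else 0#)

  -- H_n: delete rows/columns of u_1 and u_{n+2} from A_α(P_{n+2})
  H : Carrier → (n : ℕ) → Mat n
  H a n i j = Aα a (pathAdj (suc (suc n))) (suc (inject₁ i)) (suc (inject₁ j))

  -- φ(P_m), with the paper's convention φ(P_0) = (1 - 2α)/(1 - α)^2,
  -- where u is a given inverse of (1 - α).
  phiP : (a u x : Carrier) → ℕ → Carrier
  phiP a u x zero    = (1# - (a + a)) * (u * u)
  phiP a u x (suc m) = charPoly (suc m) (Aα a (pathAdj (suc m))) x

  -- φ(H_n)   (φ(H_0) = det of the empty matrix = 1, matching the convention)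
  phiH : (a x : Carrier) → ℕ → Carrier
  phiH a x n = charPoly n (H a n) x

  phiC : (a x : Carrier) → ℕ → Carrier
  phiC a x m = charPoly m (Aα a (cycleAdj m)) x

-- Write b = α - 1 and e = λ - 2α. Since every inner vertex of a path has degree 2,
-- λI - A_α(H_n) is tridiagonal with diagonal e and off-diagonal b, so expanding along the
-- first row gives φ(H_{n+2}) = e φ(H_{n+1}) - b² φ(H_n). The same expansion of φ(P_{n+2})
-- leaves determinants L_n of tridiagonal matrices with diagonal (e, …, e, λ - α), which obey
-- the same recurrence. Hence both sides of (ii) are solutions of this linear recurrence and
-- only need comparing at n = 1, 2; (i) then follows from (ii). For the cycle, the first row of
-- λI - A_α(C_{n+2}) is (e, b, 0, …, 0, b); its two off-diagonal cofactors have first column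
-- (b, 0, …, 0, b)ᵀ and split, by linearity in that column, into b φ(H_n) and a triangular
-- determinant ± bⁿ⁺¹; collecting terms uses ((-1)ⁿ)² = 1.

module Submission where

open import Defs
open import Algebra.Bundles using (CommutativeRing)
import Algebra.Solver.Ring.AlmostCommutativeRing as ACR
open import Data.Bool using (Bool; true; false; if_then_else_; _∨_; _∧_)
open import Data.Bool.Properties using (∨-identityʳ)
open import Data.Fin as Fin using (Fin; toℕ; punchIn; inject₁)
import Data.Fin.Properties as Fin
open import Data.Integer as ℤ using (ℤ; -[1+_]; _⊖_; sign; ∣_∣; _◃_) renaming (+_ to ℤ+_)
import Data.Integer.Properties as ℤ
open import Data.Maybe using (Maybe; just; nothing)
open import Data.Nat as ℕ using (ℕ; zero; suc; _<_; _≡ᵇ_; z≤n; s≤s)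
import Data.Nat.Properties as ℕ
open import Data.Product using (_×_; _,_)
open import Data.Sign as Sign using (Sign)
open import Data.Sum using (inj₁; inj₂)
open import Relation.Nullary using (yes; no)
open import Relation.Nullary.Decidable using (⌊_⌋; _because_)
open import Relation.Binary.PropositionalEquality as ≡ using (_≡_)

-- The ring solver needs a coefficient ring with decidable equality, which R itself need not
-- have; ℤ, mapped into R, serves instead.
module IntegerCoefficientSolver {c ℓ} (R : CommutativeRing c ℓ) where
  open CommutativeRing R
  open import Algebra.Properties.Ring ring using (-‿involutive; -0#≈0#; -1*x≈-x)
  open import Algebra.Properties.AbelianGroup +-abelianGroup using (⁻¹-∙-comm)
  open import Algebra.Properties.Semiring.Mult.TCOptimised semiring using (1+×; ×-homo-+; ×1-homo-*) renaming (_×_ to _×′_)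
  import Algebra.Properties.CommutativeSemigroup as CSG
  open CSG +-commutativeSemigroup using () renaming (interchange to +-interchange)
  open CSG *-commutativeSemigroup using () renaming (interchange to *-interchange)
  open import Relation.Binary.Reasoning.Setoid setoid

  fromℤ : ℤ → Carrier
  fromℤ (ℤ+ n)    = n ×′ 1#
  fromℤ -[1+ n ] = - (suc n ×′ 1#)

  fromSign : Sign → Carrier
  fromSign Sign.+ = 1#
  fromSign Sign.- = - 1#

  fromℤ-neg : ∀ i → fromℤ (ℤ.- i) ≈ - fromℤ i
  fromℤ-neg -[1+ n ]   = sym (-‿involutive _)
  fromℤ-neg (ℤ+ zero)  = sym -0#≈0#
  fromℤ-neg (ℤ+ suc n) = refl

  1+a-[1+b]≈a-b : ∀ a b → (1# + a) - (1# + b) ≈ a - b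
  1+a-[1+b]≈a-b a b = begin
    (1# + a) + - (1# + b)    ≈⟨ +-congˡ (sym (⁻¹-∙-comm _ _)) ⟩
    (1# + a) + (- 1# + - b)  ≈⟨ +-interchange _ _ _ _ ⟩
    (1# - 1#) + (a - b)      ≈⟨ +-congʳ (-‿inverseʳ _) ⟩
    0# + (a - b)             ≈⟨ +-identityˡ _ ⟩
    a - b                    ∎

  fromℤ-⊖ : ∀ m n → fromℤ (m ⊖ n) ≈ m ×′ 1# - n ×′ 1#
  fromℤ-⊖ m zero = begin
    m ×′ 1#       ≈⟨ +-identityʳ _ ⟨
    m ×′ 1# + 0#  ≈⟨ +-congˡ -0#≈0# ⟨
    m ×′ 1# - 0#  ∎
  fromℤ-⊖ zero (suc n) = sym (+-identityˡ _)
  fromℤ-⊖ (suc m) (suc n) = begin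
    fromℤ (suc m ⊖ suc n)            ≡⟨ ≡.cong fromℤ (ℤ.[1+m]⊖[1+n]≡m⊖n m n) ⟩
    fromℤ (m ⊖ n)                    ≈⟨ fromℤ-⊖ m n ⟩
    m ×′ 1# - n ×′ 1#                ≈⟨ 1+a-[1+b]≈a-b _ _ ⟨
    (1# + m ×′ 1#) - (1# + n ×′ 1#)  ≈⟨ +-cong (1+× m 1#) (-‿cong (1+× n 1#)) ⟨
    suc m ×′ 1# - suc n ×′ 1#        ∎

  fromℤ-+ : ∀ i j → fromℤ (i ℤ.+ j) ≈ fromℤ i + fromℤ j
  fromℤ-+ -[1+ m ] -[1+ n ] = begin
    - (suc (suc (m ℕ.+ n)) ×′ 1#)      ≡⟨ ≡.cong (λ t → - (suc t ×′ 1#)) (≡.sym (ℕ.+-suc m n)) ⟩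
    - ((suc m ℕ.+ suc n) ×′ 1#)        ≈⟨ -‿cong (×-homo-+ 1# (suc m) (suc n)) ⟩
    - (suc m ×′ 1# + suc n ×′ 1#)      ≈⟨ ⁻¹-∙-comm _ _ ⟨
    - (suc m ×′ 1#) + - (suc n ×′ 1#)  ∎
  fromℤ-+ -[1+ m ] (ℤ+ n)   = trans (fromℤ-⊖ n (suc m)) (+-comm _ _)
  fromℤ-+ (ℤ+ m)   -[1+ n ] = fromℤ-⊖ m (suc n)
  fromℤ-+ (ℤ+ m)   (ℤ+ n)   = ×-homo-+ 1# m n

  fromℤ-◃ : ∀ s n → fromℤ (s ◃ n) ≈ fromSign s * (n ×′ 1#)
  fromℤ-◃ s      zero    = sym (zeroʳ _)
  fromℤ-◃ Sign.+ (suc n) = sym (*-identityˡ _)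
  fromℤ-◃ Sign.- (suc n) = sym (-1*x≈-x _)

  fromSign-* : ∀ s t → fromSign (s Sign.* t) ≈ fromSign s * fromSign t
  fromSign-* Sign.+ t      = sym (*-identityˡ _)
  fromSign-* Sign.- Sign.+ = sym (*-identityʳ _)
  fromSign-* Sign.- Sign.- = sym (trans (-1*x≈-x _) (-‿involutive _))

  fromℤ≈sign*abs : ∀ i → fromℤ i ≈ fromSign (sign i) * (∣ i ∣ ×′ 1#)
  fromℤ≈sign*abs i = trans (reflexive (≡.cong fromℤ (≡.sym (ℤ.◃-inverse i)))) (fromℤ-◃ (sign i) ∣ i ∣)

  fromℤ-* : ∀ i j → fromℤ (i ℤ.* j) ≈ fromℤ i * fromℤ j
  fromℤ-* i j = begin
    fromℤ (i ℤ.* j)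
      ≈⟨ fromℤ-◃ (sign i Sign.* sign j) (∣ i ∣ ℕ.* ∣ j ∣) ⟩
    fromSign (sign i Sign.* sign j) * ((∣ i ∣ ℕ.* ∣ j ∣) ×′ 1#)
      ≈⟨ *-cong (fromSign-* (sign i) (sign j)) (×1-homo-* ∣ i ∣ ∣ j ∣) ⟩
    (fromSign (sign i) * fromSign (sign j)) * (∣ i ∣ ×′ 1# * ∣ j ∣ ×′ 1#)
      ≈⟨ *-interchange _ _ _ _ ⟩
    (fromSign (sign i) * ∣ i ∣ ×′ 1#) * (fromSign (sign j) * ∣ j ∣ ×′ 1#)
      ≈⟨ *-cong (fromℤ≈sign*abs i) (fromℤ≈sign*abs j) ⟨
    fromℤ i * fromℤ j ∎

  fromℤ-homomorphism : ℤ.+-*-rawRing ACR.-Raw-AlmostCommutative⟶ ACR.fromCommutativeRing R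
  fromℤ-homomorphism = record
    { ⟦_⟧ = fromℤ ; +-homo = fromℤ-+ ; *-homo = fromℤ-* ; -‿homo = fromℤ-neg
    ; 0-homo = refl ; 1-homo = refl }

  fromℤ-≟ : ∀ i j → Maybe (fromℤ i ≈ fromℤ j)
  fromℤ-≟ i j with i ℤ.≟ j
  ... | yes ≡.refl = just refl
  ... | no _       = nothing

  open import Algebra.Solver.Ring ℤ.+-*-rawRing (ACR.fromCommutativeRing R) fromℤ-homomorphism fromℤ-≟ public

  0ₚ 1ₚ : ∀ {n} → Polynomial n
  0ₚ = con (ℤ+ 0)
  1ₚ = con (ℤ+ 1)

module SecondOrderRecurrence {c ℓ} (R : CommutativeRing c ℓ) (p q : CommutativeRing.Carrier R) where
  open CommutativeRing R
  open IntegerCoefficientSolver R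

  IsSolution : (ℕ → Carrier) → Set ℓ
  IsSolution s = ∀ n → s (suc (suc n)) ≈ p * s (suc n) - q * s n

  solution-suc : ∀ s → IsSolution s → IsSolution (λ n → s (suc n))
  solution-suc s s-sol n = s-sol (suc n)

  solution-combination : ∀ s t a b → IsSolution s → IsSolution t → IsSolution (λ n → a * s n + b * t n)
  solution-combination s t a b s-sol t-sol n = trans (+-cong (*-congˡ (s-sol n)) (*-congˡ (t-sol n)))
    (solve 8 (λ p q a b s₁ s₀ t₁ t₀ →
        a :* (p :* s₁ :- q :* s₀) :+ b :* (p :* t₁ :- q :* t₀)
        := p :* (a :* s₁ :+ b :* t₁) :- q :* (a :* s₀ :+ b :* t₀))
      refl p q a b (s (suc n)) (s n) (t (suc n)) (t n))

  solution-unique : ∀ s t → IsSolution s → IsSolution t → s 0 ≈ t 0 → s 1 ≈ t 1 → ∀ n → s n ≈ t n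
  solution-unique s t s-sol t-sol s₀≈t₀ s₁≈t₁ = agree
    where
    agree : ∀ n → s n ≈ t n
    agree zero          = s₀≈t₀
    agree (suc zero)    = s₁≈t₁
    agree (suc (suc n)) = trans (s-sol n) (trans (+-cong (*-congˡ (agree (suc n))) (-‿cong (*-congˡ (agree n)))) (sym (t-sol n)))

module Determinants {c ℓ} (R : CommutativeRing c ℓ) where
  open CommutativeRing R hiding (zero)
  open AlphaMatrices R
  open IntegerCoefficientSolver R
  open import Relation.Binary.Reasoning.Setoid setoid

  sgn²≈1 : ∀ j → sgn j * sgn j ≈ 1#
  sgn²≈1 zero    = *-identityˡ 1#
  sgn²≈1 (suc j) = trans (solve 1 (λ s → (:- 1ₚ :* s) :* (:- 1ₚ :* s) := s :* s) refl (sgn j)) (sgn²≈1 j)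

  sumFin-cong : ∀ n {f g : Fin n → Carrier} → (∀ j → f j ≈ g j) → sumFin n f ≈ sumFin n g
  sumFin-cong zero    f≈g = refl
  sumFin-cong (suc n) f≈g = +-cong (f≈g Fin.zero) (sumFin-cong n (λ j → f≈g (Fin.suc j)))

  det-cong : ∀ n (M N : Mat n) → (∀ i j → M i j ≈ N i j) → det n M ≈ det n N
  det-cong zero    M N M≈N = refl
  det-cong (suc n) M N M≈N = sumFin-cong (suc n)
    {λ j → sgn (toℕ j) * (M Fin.zero j * det n (λ i k → M (Fin.suc i) (punchIn j k)))}
    {λ j → sgn (toℕ j) * (N Fin.zero j * det n (λ i k → N (Fin.suc i) (punchIn j k)))} λ j →
    *-congˡ (*-cong (M≈N Fin.zero j) (det-cong n _ _ (λ i k → M≈N (Fin.suc i) (punchIn j k))))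

  -- ℕ-indexed matrices, of which detℕ n takes the n × n corner; this avoids arithmetic in Fin.
  Matℕ : Set c
  Matℕ = ℕ → ℕ → Carrier

  detℕ : ℕ → Matℕ → Carrier
  detℕ n M = det n (λ i j → M (toℕ i) (toℕ j))

  detℕ-cong : ∀ n (M N : Matℕ) → (∀ I J → I < n → J < n → M I J ≈ N I J) → detℕ n M ≈ detℕ n N
  detℕ-cong n M N M≈N = det-cong n _ _ (λ i j → M≈N (toℕ i) (toℕ j) (Fin.toℕ<n i) (Fin.toℕ<n j))

  sumℕ : ℕ → (ℕ → Carrier) → Carrier
  sumℕ zero    f = 0#
  sumℕ (suc n) f = f 0 + sumℕ n (λ J → f (suc J))

  sumFin≡sumℕ : ∀ n (f : ℕ → Carrier) → sumFin n (λ j → f (toℕ j)) ≡ sumℕ n f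
  sumFin≡sumℕ zero    f = ≡.refl
  sumFin≡sumℕ (suc n) f = ≡.cong (λ t → f 0 + t) (sumFin≡sumℕ n (λ J → f (suc J)))

  sumℕ-cong : ∀ n {f g : ℕ → Carrier} → (∀ J → J < n → f J ≈ g J) → sumℕ n f ≈ sumℕ n g
  sumℕ-cong zero    f≈g = refl
  sumℕ-cong (suc n) f≈g = +-cong (f≈g 0 (s≤s z≤n)) (sumℕ-cong n (λ J J<n → f≈g (suc J) (s≤s J<n)))

  sumℕ-zero : ∀ n {f : ℕ → Carrier} → (∀ J → J < n → f J ≈ 0#) → sumℕ n f ≈ 0#
  sumℕ-zero n f≈0 = trans (sumℕ-cong n f≈0) (zeros n)
    where
    zeros : ∀ n → sumℕ n (λ _ → 0#) ≈ 0#
    zeros zero    = refl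
    zeros (suc n) = trans (+-identityˡ _) (zeros n)

  sumℕ-+ : ∀ n (f g : ℕ → Carrier) → sumℕ n (λ J → f J + g J) ≈ sumℕ n f + sumℕ n g
  sumℕ-+ zero    f g = sym (+-identityʳ 0#)
  sumℕ-+ (suc n) f g = trans (+-congˡ (sumℕ-+ n _ _))
    (solve 4 (λ a b c d → (a :+ b) :+ (c :+ d) := (a :+ c) :+ (b :+ d)) refl _ _ _ _)

  sumℕ-*ˡ : ∀ n r (f : ℕ → Carrier) → sumℕ n (λ J → r * f J) ≈ r * sumℕ n f
  sumℕ-*ˡ zero    r f = sym (zeroʳ r)
  sumℕ-*ˡ (suc n) r f = trans (+-congˡ (sumℕ-*ˡ n r _)) (sym (distribˡ _ _ _))

  sumℕ-last : ∀ n (f : ℕ → Carrier) → sumℕ (suc n) f ≈ sumℕ n f + f n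
  sumℕ-last zero    f = trans (+-identityʳ _) (sym (+-identityˡ _))
  sumℕ-last (suc n) f = trans (+-congˡ (sumℕ-last n _)) (sym (+-assoc _ _ _))

  punchInℕ : ℕ → ℕ → ℕ
  punchInℕ zero    k       = suc k
  punchInℕ (suc j) zero    = zero
  punchInℕ (suc j) (suc k) = suc (punchInℕ j k)

  toℕ-punchIn : ∀ {n} (j : Fin (suc n)) (k : Fin n) → toℕ (punchIn j k) ≡ punchInℕ (toℕ j) (toℕ k)
  toℕ-punchIn Fin.zero    k           = ≡.refl
  toℕ-punchIn (Fin.suc j) Fin.zero    = ≡.refl
  toℕ-punchIn (Fin.suc j) (Fin.suc k) = ≡.cong suc (toℕ-punchIn j k)

  punchInℕ-< : ∀ {j k} → k < j → punchInℕ j k ≡ k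
  punchInℕ-< {suc j} {zero}  _         = ≡.refl
  punchInℕ-< {suc j} {suc k} (s≤s k<j) = ≡.cong suc (punchInℕ-< k<j)

  minor : ℕ → Matℕ → Matℕ
  minor J M I K = M (suc I) (punchInℕ J K)

  detℕ-expand : ∀ n M → detℕ (suc n) M ≈ sumℕ (suc n) (λ J → sgn J * (M 0 J * detℕ n (minor J M)))
  detℕ-expand n M = trans
    (sumFin-cong (suc n) {g = λ j → sgn (toℕ j) * (M 0 (toℕ j) * detℕ n (minor (toℕ j) M))} λ j →
       *-congˡ (*-congˡ (det-cong n _ _ λ i k →
       reflexive (≡.cong (M (suc (toℕ i))) (toℕ-punchIn j k)))))
    (reflexive (sumFin≡sumℕ (suc n) (λ J → sgn J * (M 0 J * detℕ n (minor J M)))))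

  detℕ-1 : ∀ M → detℕ 1 M ≈ M 0 0
  detℕ-1 M = trans (+-identityʳ _) (trans (*-identityˡ _) (*-identityʳ _))

  consColumn : (ℕ → Carrier) → Matℕ → Matℕ
  consColumn v B I zero    = v I
  consColumn v B I (suc K) = B I K

  unitColumn : ℕ → Carrier → ℕ → Carrier
  unitColumn J r I = if I ℕ.≡ᵇ J then r else 0#

  s*[0*d]≈0 : ∀ s d → s * (0# * d) ≈ 0#
  s*[0*d]≈0 s d = trans (*-congˡ (zeroˡ d)) (zeroʳ s)

  s*[a*0]≈0 : ∀ s a {d} → d ≈ 0# → s * (a * d) ≈ 0#
  s*[a*0]≈0 s a d≈0 = trans (*-congˡ (trans (*-congˡ d≈0) (zeroʳ a))) (zeroʳ s)

  minor-consColumn : ∀ n J v B → detℕ n (minor (suc J) (consColumn v B)) ≈ detℕ n (consColumn (λ I → v (suc I)) (minor J B))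
  minor-consColumn n J v B = det-cong n _ _ λ i k → entry (toℕ i) (toℕ k)
    where
    entry : ∀ I K → minor (suc J) (consColumn v B) I K ≈ consColumn (λ I → v (suc I)) (minor J B) I K
    entry I zero    = refl
    entry I (suc K) = refl

  detℕ-zeroColumn : ∀ n M → (∀ I → M I 0 ≈ 0#) → detℕ (suc n) M ≈ 0#
  detℕ-zeroColumn n M col≈0 = trans (detℕ-expand n M)
    (trans (+-cong (trans (*-congˡ (*-congʳ (col≈0 0))) (s*[0*d]≈0 _ _)) (sumℕ-zero n (later n)))
           (+-identityʳ 0#))
    where
    later : ∀ n J → J < n → sgn (suc J) * (M 0 (suc J) * detℕ n (minor (suc J) M)) ≈ 0#
    later (suc n) J _ = s*[a*0]≈0 _ _ (detℕ-zeroColumn n (minor (suc J) M) (λ I → col≈0 (suc I)))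

  detℕ-firstColumn-top : ∀ n r B → detℕ (suc n) (consColumn (unitColumn 0 r) B) ≈ r * detℕ n (λ I K → B (suc I) K)
  detℕ-firstColumn-top n r B = trans (detℕ-expand n (consColumn (unitColumn 0 r) B))
    (trans (+-cong (*-identityˡ _) (sumℕ-zero n (later n))) (+-identityʳ _))
    where
    later : ∀ n J → J < n → sgn (suc J) * (B 0 J * detℕ n (minor (suc J) (consColumn (unitColumn 0 r) B))) ≈ 0#
    later (suc n) J _ = s*[a*0]≈0 _ _ (detℕ-zeroColumn n (minor (suc J) (consColumn (unitColumn 0 r) B)) (λ I → refl))

  detℕ-firstColumn-bottom : ∀ n r B → detℕ (suc n) (consColumn (unitColumn n r) B) ≈ sgn n * (r * detℕ n B)
  detℕ-firstColumn-bottom zero    r B = +-identityʳ _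
  detℕ-firstColumn-bottom (suc n) r B = begin
    detℕ (suc (suc n)) (consColumn (unitColumn (suc n) r) B)
      ≈⟨ detℕ-expand (suc n) (consColumn (unitColumn (suc n) r) B) ⟩
    sgn 0 * (0# * detℕ (suc n) (minor 0 (consColumn (unitColumn (suc n) r) B)))
      + sumℕ (suc n) (λ J → sgn (suc J) * (B 0 J * detℕ (suc n) (minor (suc J) (consColumn (unitColumn (suc n) r) B))))
      ≈⟨ +-cong (s*[0*d]≈0 _ _) (sumℕ-cong (suc n) term) ⟩
    0# + sumℕ (suc n) (λ J → s * expansionTerm J)  ≈⟨ +-identityˡ _ ⟩
    sumℕ (suc n) (λ J → s * expansionTerm J)       ≈⟨ sumℕ-*ˡ (suc n) s expansionTerm ⟩
    s * sumℕ (suc n) expansionTerm                 ≈⟨ *-congˡ (detℕ-expand n B) ⟨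
    s * detℕ (suc n) B
      ≈⟨ solve 3 (λ t r d → (:- 1ₚ :* t :* r) :* d := (:- 1ₚ :* t) :* (r :* d)) refl (sgn n) r (detℕ (suc n) B) ⟩
    sgn (suc n) * (r * detℕ (suc n) B) ∎
    where
    s : Carrier
    s = - 1# * sgn n * r
    expansionTerm : ℕ → Carrier
    expansionTerm J = sgn J * (B 0 J * detℕ n (minor J B))
    term : ∀ J → J < suc n →
      sgn (suc J) * (B 0 J * detℕ (suc n) (minor (suc J) (consColumn (unitColumn (suc n) r) B))) ≈ s * expansionTerm J
    term J _ = begin
      sgn (suc J) * (B 0 J * detℕ (suc n) (minor (suc J) (consColumn (unitColumn (suc n) r) B)))
        ≈⟨ *-congˡ (*-congˡ (trans (minor-consColumn (suc n) J (unitColumn (suc n) r) B) (detℕ-firstColumn-bottom n r (minor J B)))) ⟩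
      sgn (suc J) * (B 0 J * (sgn n * (r * detℕ n (minor J B))))
        ≈⟨ solve 5 (λ t b u r d → (:- 1ₚ :* t) :* (b :* (u :* (r :* d))) := (:- 1ₚ :* u :* r) :* (t :* (b :* d)))
                   refl (sgn J) (B 0 J) (sgn n) r (detℕ n (minor J B)) ⟩
      s * expansionTerm J ∎

  detℕ-firstColumn-+ : ∀ n v w B →
    detℕ (suc n) (consColumn (λ I → v I + w I) B) ≈ detℕ (suc n) (consColumn v B) + detℕ (suc n) (consColumn w B)
  detℕ-firstColumn-+ n v w B = begin
    detℕ (suc n) (consColumn (λ I → v I + w I) B)            ≈⟨ detℕ-expand n (consColumn (λ I → v I + w I) B) ⟩
    sumℕ (suc n) (λ J → sgn J * (consColumn (λ I → v I + w I) B 0 J * detℕ n (minor J (consColumn (λ I → v I + w I) B))))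
                                                             ≈⟨ sumℕ-cong (suc n) (term n) ⟩
    sumℕ (suc n) (λ J → expansionTerm v J + expansionTerm w J) ≈⟨ sumℕ-+ (suc n) (expansionTerm v) (expansionTerm w) ⟩
    sumℕ (suc n) (expansionTerm v) + sumℕ (suc n) (expansionTerm w)
                                                             ≈⟨ +-cong (detℕ-expand n (consColumn v B)) (detℕ-expand n (consColumn w B)) ⟨
    detℕ (suc n) (consColumn v B) + detℕ (suc n) (consColumn w B) ∎
    where
    expansionTerm : (ℕ → Carrier) → ℕ → Carrier
    expansionTerm u J = sgn J * (consColumn u B 0 J * detℕ n (minor J (consColumn u B)))
    term : ∀ n J → J < suc n →
      sgn J * (consColumn (λ I → v I + w I) B 0 J * detℕ n (minor J (consColumn (λ I → v I + w I) B)))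
        ≈ sgn J * (consColumn v B 0 J * detℕ n (minor J (consColumn v B))) + sgn J * (consColumn w B 0 J * detℕ n (minor J (consColumn w B)))
    term n zero _ = solve 4 (λ s a b d → s :* ((a :+ b) :* d) := s :* (a :* d) :+ s :* (b :* d)) refl _ _ _ _
    term zero    (suc J) (s≤s ())
    term (suc n) (suc J) _ = begin
      sgn (suc J) * (B 0 J * detℕ (suc n) (minor (suc J) (consColumn (λ I → v I + w I) B)))
        ≈⟨ *-congˡ (*-congˡ (trans (minor-consColumn (suc n) J (λ I → v I + w I) B) (detℕ-firstColumn-+ n _ _ (minor J B)))) ⟩
      sgn (suc J) * (B 0 J * (detℕ (suc n) (consColumn (λ I → v (suc I)) (minor J B))
                              + detℕ (suc n) (consColumn (λ I → w (suc I)) (minor J B))))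
        ≈⟨ solve 4 (λ s a b d → s :* (a :* (b :+ d)) := s :* (a :* b) :+ s :* (a :* d)) refl _ _ _ _ ⟩
      _ ≈⟨ +-cong (*-congˡ (*-congˡ (minor-consColumn (suc n) J v B))) (*-congˡ (*-congˡ (minor-consColumn (suc n) J w B))) ⟨
      _ ∎

  detℕ-firstColumn-top+bottom : ∀ n r B →
    detℕ (suc n) (consColumn (λ I → unitColumn 0 r I + unitColumn n r I) B)
      ≈ r * detℕ n (λ I K → B (suc I) K) + sgn n * (r * detℕ n B)
  detℕ-firstColumn-top+bottom n r B = trans (detℕ-firstColumn-+ n (unitColumn 0 r) (unitColumn n r) B)
    (+-cong (detℕ-firstColumn-top n r B) (detℕ-firstColumn-bottom n r B))

module Tridiagonal {c ℓ} (R : CommutativeRing c ℓ) (b : CommutativeRing.Carrier R) where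
  open CommutativeRing R hiding (zero)
  open AlphaMatrices R
  open IntegerCoefficientSolver R
  open Determinants R
  open import Relation.Binary.Reasoning.Setoid setoid

  tri : (ℕ → Carrier) → Matℕ
  tri d zero          zero          = d zero
  tri d zero          (suc zero)    = b
  tri d zero          (suc (suc _)) = 0#
  tri d (suc I)       (suc J)       = tri (λ K → d (suc K)) I J
  tri d (suc zero)    zero          = b
  tri d (suc (suc _)) zero          = 0#

  tri-cong : ∀ n {d d′} → (∀ I → I < n → d I ≈ d′ I) → ∀ I J → I < n → tri d I J ≈ tri d′ I J
  tri-cong n       d≈d′ zero          zero          I<n       = d≈d′ 0 I<n
  tri-cong n       d≈d′ zero          (suc zero)    _         = refl
  tri-cong n       d≈d′ zero          (suc (suc J)) _         = refl
  tri-cong n       d≈d′ (suc zero)    zero          _         = refl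
  tri-cong n       d≈d′ (suc (suc I)) zero          _         = refl
  tri-cong (suc n) d≈d′ (suc I)       (suc J)       (s≤s I<n) = tri-cong n (λ K K<n → d≈d′ (suc K) (s≤s K<n)) I J I<n

  detTri-cong : ∀ n {d d′} → (∀ I → I < n → d I ≈ d′ I) → detℕ n (tri d) ≈ detℕ n (tri d′)
  detTri-cong n d≈d′ = detℕ-cong n _ _ (λ I J I<n _ → tri-cong n d≈d′ I J I<n)

  detTri-recurrence : ∀ n d → detℕ (suc (suc n)) (tri d) ≈
    d 0 * detℕ (suc n) (tri (λ K → d (suc K))) - b * b * detℕ n (tri (λ K → d (suc (suc K))))
  detTri-recurrence n d = begin
    detℕ (suc (suc n)) (tri d)
      ≈⟨ detℕ-expand (suc n) (tri d) ⟩
    sgn 0 * (d 0 * A) + (sgn 1 * (b * detℕ (suc n) (minor 1 (tri d)))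
      + sumℕ n (λ J → sgn (suc (suc J)) * (0# * detℕ (suc n) (minor (suc (suc J)) (tri d)))))
      ≈⟨ +-congˡ (+-cong (*-congˡ (*-congˡ minor₁)) (sumℕ-zero n (λ J _ → s*[0*d]≈0 _ _))) ⟩
    sgn 0 * (d 0 * A) + (sgn 1 * (b * (b * C)) + 0#)
      ≈⟨ solve 4 (λ d a b c → 1ₚ :* (d :* a) :+ ((:- 1ₚ :* 1ₚ) :* (b :* (b :* c)) :+ 0ₚ) := d :* a :- b :* b :* c) refl (d 0) A b C ⟩
    d 0 * A - b * b * C ∎
    where
    A C : Carrier
    A = detℕ (suc n) (tri (λ K → d (suc K)))
    C = detℕ n (tri (λ K → d (suc (suc K))))
    minor₁-shape : ∀ I K → minor 1 (tri d) I K ≈ consColumn (unitColumn 0 b) (λ I K → tri (λ K → d (suc K)) I (suc K)) I K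
    minor₁-shape zero    zero    = refl
    minor₁-shape (suc I) zero    = refl
    minor₁-shape I       (suc K) = refl
    minor₁ : detℕ (suc n) (minor 1 (tri d)) ≈ b * C
    minor₁ = trans (det-cong (suc n) _ _ (λ i k → minor₁-shape (toℕ i) (toℕ k)))
                   (detℕ-firstColumn-top n b (λ I K → tri (λ K → d (suc K)) I (suc K)))

  -- Without its first column, tri d is lower triangular with diagonal b.
  detTri-dropFirstColumn : ∀ n d → detℕ n (λ I K → tri d I (suc K)) ≈ pow b n
  detTri-dropFirstColumn zero    d = refl
  detTri-dropFirstColumn (suc n) d = begin
    detℕ (suc n) (λ I K → tri d I (suc K))
      ≈⟨ detℕ-expand n (λ I K → tri d I (suc K)) ⟩
    sgn 0 * (b * detℕ n (λ I K → tri (λ K → d (suc K)) I (suc K)))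
      + sumℕ n (λ J → sgn (suc J) * (0# * detℕ n (minor (suc J) (λ I K → tri d I (suc K)))))
      ≈⟨ +-cong (trans (*-identityˡ _) (*-congˡ (detTri-dropFirstColumn n _))) (sumℕ-zero n (λ J _ → s*[0*d]≈0 _ _)) ⟩
    b * pow b n + 0# ≈⟨ +-identityʳ _ ⟩
    pow b (suc n) ∎

  -- Without its first row, tri d is upper triangular with diagonal b.
  detTri-dropFirstRow : ∀ n d → detℕ n (λ I K → tri d (suc I) K) ≈ pow b n
  detTri-dropFirstRow zero    d = refl
  detTri-dropFirstRow (suc n) d = begin
    detℕ (suc n) (λ I K → tri d (suc I) K)
      ≈⟨ detℕ-expand n (λ I K → tri d (suc I) K) ⟩
    sgn 0 * (b * detℕ n (λ I K → tri (λ K → d (suc K)) (suc I) K))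
      + sumℕ n (λ J → sgn (suc J) * (tri d 1 (suc J) * detℕ n (minor (suc J) (λ I K → tri d (suc I) K))))
      ≈⟨ +-cong (trans (*-identityˡ _) (*-congˡ (detTri-dropFirstRow n _))) (sumℕ-zero n (later n)) ⟩
    b * pow b n + 0# ≈⟨ +-identityʳ _ ⟩
    pow b (suc n) ∎
    where
    later : ∀ n J → J < n → sgn (suc J) * (tri d 1 (suc J) * detℕ n (minor (suc J) (λ I K → tri d (suc I) K))) ≈ 0#
    later (suc n) J _ = s*[a*0]≈0 _ _ (detℕ-zeroColumn n (minor (suc J) (λ I K → tri d (suc I) K)) (λ I → refl))

countℕ : ℕ → (ℕ → Bool) → ℕ
countℕ zero    p = 0
countℕ (suc m) p = (if p 0 then 1 else 0) ℕ.+ countℕ m (λ J → p (suc J))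

countFin≡countℕ : ∀ m p → countFin m (λ j → p (toℕ j)) ≡ countℕ m p
countFin≡countℕ zero    p = ≡.refl
countFin≡countℕ (suc m) p = ≡.cong ((if p 0 then 1 else 0) ℕ.+_) (countFin≡countℕ m (λ J → p (suc J)))

countℕ-cong : ∀ m {p q} → (∀ J → p J ≡ q J) → countℕ m p ≡ countℕ m q
countℕ-cong zero    p≡q = ≡.refl
countℕ-cong (suc m) p≡q = ≡.cong₂ (λ b n → (if b then 1 else 0) ℕ.+ n) (p≡q 0) (countℕ-cong m (λ J → p≡q (suc J)))

countℕ-false : ∀ m → countℕ m (λ _ → false) ≡ 0
countℕ-false zero    = ≡.refl
countℕ-false (suc m) = countℕ-false m

countℕ-≡ᵇ : ∀ {m t} → t < m → countℕ m (_≡ᵇ t) ≡ 1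
countℕ-≡ᵇ {suc m} {zero}  _         = ≡.cong suc (countℕ-false m)
countℕ-≡ᵇ {suc m} {suc t} (s≤s t<m) = countℕ-≡ᵇ t<m

≡ᵇ-refl : ∀ n → (n ≡ᵇ n) ≡ true
≡ᵇ-refl zero    = ≡.refl
≡ᵇ-refl (suc n) = ≡ᵇ-refl n

<⇒≡ᵇ-false : ∀ {m n} → m < n → (m ≡ᵇ n) ≡ false
<⇒≡ᵇ-false {zero}  {suc n} _         = ≡.refl
<⇒≡ᵇ-false {suc m} {suc n} (s≤s m<n) = <⇒≡ᵇ-false m<n

⌊≟⌋≡toℕ-≡ᵇ : ∀ {m} (i j : Fin m) → ⌊ i Fin.≟ j ⌋ ≡ (toℕ i ≡ᵇ toℕ j)
⌊≟⌋≡toℕ-≡ᵇ Fin.zero    Fin.zero    = ≡.refl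
⌊≟⌋≡toℕ-≡ᵇ Fin.zero    (Fin.suc j) = ≡.refl
⌊≟⌋≡toℕ-≡ᵇ (Fin.suc i) Fin.zero    = ≡.refl
⌊≟⌋≡toℕ-≡ᵇ (Fin.suc i) (Fin.suc j) with i Fin.≟ j | ⌊≟⌋≡toℕ-≡ᵇ i j
... | true  because _ | eq = eq
... | false because _ | eq = eq

-- pathAdj m and cycleAdj m are, definitionally, these functions applied to toℕ of the indices.
pathAdjℕ : ℕ → ℕ → Bool
pathAdjℕ I J = (I ≡ᵇ suc J) ∨ (J ≡ᵇ suc I)

cycleAdjℕ : ℕ → ℕ → ℕ → Bool
cycleAdjℕ m I J = pathAdjℕ I J ∨ ((I ≡ᵇ 0) ∧ (J ≡ᵇ (m ℕ.∸ 1))) ∨ ((J ≡ᵇ 0) ∧ (I ≡ᵇ (m ℕ.∸ 1)))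

pathDegree : ℕ → ℕ → ℕ
pathDegree m I = countℕ m (pathAdjℕ I)

cycleDegree : ℕ → ℕ → ℕ
cycleDegree m I = countℕ m (cycleAdjℕ m I)

pathDegree-first : ∀ n → pathDegree (suc (suc n)) 0 ≡ 1
pathDegree-first n = ≡.cong suc (countℕ-false n)

pathDegree-inner : ∀ {n I} → I < n → pathDegree (suc (suc n)) (suc I) ≡ 2
pathDegree-inner {suc n} {zero}  _         = ≡.cong suc (pathDegree-first n)
pathDegree-inner {suc n} {suc I} (s≤s I<n) = pathDegree-inner I<n

pathDegree-last : ∀ n → pathDegree (suc (suc n)) (suc n) ≡ 1
pathDegree-last zero    = ≡.refl
pathDegree-last (suc n) = pathDegree-last n

cycleDegree-suc : ∀ k I → cycleDegree (suc (suc (suc k))) (suc I)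
                  ≡ (if ((I ≡ᵇ 0) ∨ false) ∨ (I ≡ᵇ suc k) then 1 else 0) ℕ.+ pathDegree (suc (suc k)) I
cycleDegree-suc k I = ≡.cong ((if ((I ≡ᵇ 0) ∨ false) ∨ (I ≡ᵇ suc k) then 1 else 0) ℕ.+_)
  (countℕ-cong (suc (suc k)) (λ J → ∨-identityʳ (pathAdjℕ I J)))

cycleDegree≡2 : ∀ k {I} → I < suc (suc (suc k)) → cycleDegree (suc (suc (suc k))) I ≡ 2
cycleDegree≡2 k {zero} _ =
  ≡.cong suc (≡.trans (countℕ-cong (suc k) (λ J → ∨-identityʳ (J ≡ᵇ k))) (countℕ-≡ᵇ (ℕ.n<1+n k)))
cycleDegree≡2 k {suc zero} _ = ≡.trans (cycleDegree-suc k 0) (≡.cong suc (pathDegree-first k))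
cycleDegree≡2 k {suc (suc I)} (s≤s (s≤s (s≤s I≤k))) with ℕ.m≤n⇒m<n∨m≡n I≤k
... | inj₁ I<k    rewrite cycleDegree-suc k (suc I) | <⇒≡ᵇ-false I<k = pathDegree-inner (s≤s I<k)
... | inj₂ ≡.refl rewrite cycleDegree-suc k (suc I) | ≡ᵇ-refl I     = ≡.cong suc (pathDegree-last (suc I))

module CharacteristicMatrix {c ℓ} (R : CommutativeRing c ℓ) (α x : CommutativeRing.Carrier R) where
  open CommutativeRing R hiding (zero)
  open AlphaMatrices R
  open IntegerCoefficientSolver R
  open Determinants R

  -- An entry of λI - A_α(G), from: whether it lies on the diagonal (tested twice, since the
  -- submatrix H_n tests it in two different index types), the degree, and adjacency.
  entryOf : Bool → Bool → ℕ → Bool → Carrier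
  entryOf diag diag′ deg adjacent =
    (if diag then x else 0#) - (α * (if diag′ then fromℕ deg else 0#) + (1# - α) * (if adjacent then 1# else 0#))

  charEntry : (ℕ → ℕ → Bool) → (ℕ → ℕ) → Matℕ
  charEntry adj deg I J = entryOf (I ≡ᵇ J) (I ≡ᵇ J) (deg I) (adj I J)

  b e : Carrier
  b = α - 1#
  e = x - (α + α)

  bₚ : ∀ {n} → Polynomial n → Polynomial n
  bₚ a = a :- 1ₚ

  eₚ : ∀ {n} → Polynomial n → Polynomial n → Polynomial n
  eₚ x a = x :- (a :+ a)

  entryOf-diagonal : ∀ deg → entryOf true true deg false ≈ x - α * fromℕ deg
  entryOf-diagonal deg =
    solve 3 (λ x a k → x :- (a :* k :+ (1ₚ :- a) :* 0ₚ) := x :- a :* k) refl x α (fromℕ deg)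

  entryOf-adjacent : ∀ deg → entryOf false false deg true ≈ b
  entryOf-adjacent _ =
    solve 1 (λ a → 0ₚ :- (a :* 0ₚ :+ (1ₚ :- a) :* 1ₚ) := bₚ a) refl α

  entryOf-nonadjacent : ∀ deg → entryOf false false deg false ≈ 0#
  entryOf-nonadjacent _ =
    solve 1 (λ a → 0ₚ :- (a :* 0ₚ :+ (1ₚ :- a) :* 0ₚ) := 0ₚ) refl α

  charPoly-Aα : ∀ m adj → charPoly m (Aα α (λ i j → adj (toℕ i) (toℕ j))) x
                          ≈ detℕ m (charEntry adj (λ I → countℕ m (adj I)))
  charPoly-Aα m adj = det-cong m _ _ λ i j → reflexive
    (≡.cong₂ (λ d k → entryOf d d k (adj (toℕ i) (toℕ j))) (⌊≟⌋≡toℕ-≡ᵇ i j) (countFin≡countℕ m (adj (toℕ i))))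

  charPoly-H : ∀ n → phiH α x n ≈ detℕ n (λ I J → charEntry pathAdjℕ (pathDegree (suc (suc n))) (suc I) (suc J))
  charPoly-H n = det-cong n _ _ λ i j → reflexive (entry i j)
    where
    entry : ∀ i j → entryOf ⌊ i Fin.≟ j ⌋ ⌊ Fin.suc (inject₁ i) Fin.≟ Fin.suc (inject₁ j) ⌋
                      (degree (pathAdj (suc (suc n))) (Fin.suc (inject₁ i))) (pathAdjℕ (suc (toℕ (inject₁ i))) (suc (toℕ (inject₁ j))))
                    ≡ charEntry pathAdjℕ (pathDegree (suc (suc n))) (suc (toℕ i)) (suc (toℕ j))
    entry i j rewrite ⌊≟⌋≡toℕ-≡ᵇ i j | ⌊≟⌋≡toℕ-≡ᵇ (Fin.suc (inject₁ i)) (Fin.suc (inject₁ j))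
                    | countFin≡countℕ (suc (suc n)) (pathAdjℕ (suc (toℕ (inject₁ i))))
                    | Fin.toℕ-inject₁ i | Fin.toℕ-inject₁ j = ≡.refl

  open Tridiagonal R b
  open import Relation.Binary.Reasoning.Setoid setoid

  charEntry-tri : ∀ adj → (∀ I J → adj I J ≡ pathAdjℕ I J) →
                  ∀ deg I J → charEntry adj deg I J ≈ tri (λ K → x - α * fromℕ (deg K)) I J
  charEntry-tri adj adj≡ deg zero          zero          rewrite adj≡ 0 0             = entryOf-diagonal (deg 0)
  charEntry-tri adj adj≡ deg zero          (suc zero)    rewrite adj≡ 0 1             = entryOf-adjacent (deg 0)
  charEntry-tri adj adj≡ deg zero          (suc (suc J)) rewrite adj≡ 0 (suc (suc J)) = entryOf-nonadjacent (deg 0)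
  charEntry-tri adj adj≡ deg (suc I)       (suc J)       =
    charEntry-tri (λ I J → adj (suc I) (suc J)) (λ I J → adj≡ (suc I) (suc J)) (λ K → deg (suc K)) I J
  charEntry-tri adj adj≡ deg (suc zero)    zero          rewrite adj≡ 1 0             = entryOf-adjacent (deg 1)
  charEntry-tri adj adj≡ deg (suc (suc I)) zero          rewrite adj≡ (suc (suc I)) 0 = entryOf-nonadjacent (deg (suc (suc I)))

  diagonal-degree₂ : ∀ {k} → k ≡ 2 → x - α * fromℕ k ≈ e
  diagonal-degree₂ ≡.refl = solve 2 (λ x a → x :- a :* (1ₚ :+ (1ₚ :+ 0ₚ)) := eₚ x a) refl x α

  diagonal-degree₁ : ∀ {k} → k ≡ 1 → x - α * fromℕ k ≈ x - α
  diagonal-degree₁ ≡.refl = solve 2 (λ x a → x :- a :* (1ₚ :+ 0ₚ) := x :- a) refl x α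

  E : ℕ → Carrier
  E n = detℕ n (tri (λ _ → e))

  phiH≈E : ∀ n → phiH α x n ≈ E n
  phiH≈E n = begin
    phiH α x n
      ≈⟨ charPoly-H n ⟩
    detℕ n (λ I J → charEntry pathAdjℕ (pathDegree (suc (suc n))) (suc I) (suc J))
      ≈⟨ detℕ-cong n _ _ (λ I J _ _ →
           charEntry-tri (λ I J → pathAdjℕ (suc I) (suc J)) (λ _ _ → ≡.refl) (λ K → pathDegree (suc (suc n)) (suc K)) I J) ⟩
    detℕ n (tri (λ K → x - α * fromℕ (pathDegree (suc (suc n)) (suc K))))
      ≈⟨ detTri-cong n (λ I I<n → diagonal-degree₂ (pathDegree-inner I<n)) ⟩
    E n ∎

  endDiagonal : ℕ → ℕ → Carrier
  endDiagonal n I = if suc I ≡ᵇ n then x - α else e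

  -- L n is φ(P_{n+1}) with the row and column of u₁ deleted.
  L : ℕ → Carrier
  L n = detℕ n (tri (endDiagonal n))

  pathDiagonal : ℕ → ℕ → Carrier
  pathDiagonal n zero    = x - α
  pathDiagonal n (suc I) = endDiagonal n I

  pathDiagonal-degree : ∀ n {I} → I < suc (suc n) → x - α * fromℕ (pathDegree (suc (suc n)) I) ≈ pathDiagonal (suc n) I
  pathDiagonal-degree n {zero}  _ = diagonal-degree₁ (pathDegree-first n)
  pathDiagonal-degree n {suc I} (s≤s (s≤s I≤n)) with ℕ.m≤n⇒m<n∨m≡n I≤n
  ... | inj₁ I<n    rewrite <⇒≡ᵇ-false I<n = diagonal-degree₂ (pathDegree-inner I<n)
  ... | inj₂ ≡.refl rewrite ≡ᵇ-refl I    = diagonal-degree₁ (pathDegree-last I)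

  phiP-expand : ∀ {u} n → phiP α u x (suc (suc n)) ≈ (x - α) * L (suc n) - b * b * L n
  phiP-expand n = begin
    charPoly (suc (suc n)) (Aα α (pathAdj (suc (suc n)))) x
      ≈⟨ charPoly-Aα (suc (suc n)) pathAdjℕ ⟩
    detℕ (suc (suc n)) (charEntry pathAdjℕ (pathDegree (suc (suc n))))
      ≈⟨ detℕ-cong (suc (suc n)) _ _ (λ I J _ _ → charEntry-tri pathAdjℕ (λ _ _ → ≡.refl) (pathDegree (suc (suc n))) I J) ⟩
    detℕ (suc (suc n)) (tri (λ K → x - α * fromℕ (pathDegree (suc (suc n)) K)))
      ≈⟨ detTri-cong (suc (suc n)) (λ I → pathDiagonal-degree n) ⟩
    detℕ (suc (suc n)) (tri (pathDiagonal (suc n)))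
      ≈⟨ detTri-recurrence n (pathDiagonal (suc n)) ⟩
    (x - α) * L (suc n) - b * b * L n ∎

  phiP-1 : ∀ {u} → phiP α u x 1 ≈ x
  phiP-1 = trans (charPoly-Aα 1 pathAdjℕ) (trans (detℕ-1 (charEntry pathAdjℕ (pathDegree 1)))
    (solve 2 (λ x a → x :- (a :* 0ₚ :+ (1ₚ :- a) :* 0ₚ) := x) refl x α))

module PathIdentities {c ℓ} (R : CommutativeRing c ℓ) (α x : CommutativeRing.Carrier R) where
  open CommutativeRing R hiding (zero)
  open import Algebra.Properties.Ring ring using (-‿distribˡ-*)
  open AlphaMatrices R
  open IntegerCoefficientSolver R
  open Determinants R
  open CharacteristicMatrix R α x
  open Tridiagonal R b
  open SecondOrderRecurrence R e (b * b)
  open import Relation.Binary.Reasoning.Setoid setoid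

  E-solution : IsSolution E
  E-solution n = detTri-recurrence n (λ _ → e)

  L-solution : IsSolution L
  L-solution n = detTri-recurrence n (endDiagonal (suc (suc n)))

  pathCombination : ℕ → Carrier
  pathCombination k = x * E (suc k) + ((α + α) - 1#) * E k

  pathCombination-solution : IsSolution pathCombination
  pathCombination-solution = solution-combination _ E x ((α + α) - 1#) (solution-suc E E-solution) E-solution

  E-1 : E 1 ≈ e
  E-1 = detℕ-1 (tri (λ _ → e))

  E-2 : E 2 ≈ e * e - b * b * 1#
  E-2 = trans (E-solution 0) (+-congʳ (*-congˡ E-1))

  -- Both sides solve the recurrence of E, so it suffices to compare them for k = 0, 1.
  phiP≈pathCombination : ∀ {u} k → phiP α u x (suc (suc k)) ≈ pathCombination k
  phiP≈pathCombination {u} k = trans (phiP-expand {u} k)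
    (trans (+-congˡ (-‿distribˡ-* (b * b) (L k)))
      (solution-unique expansion pathCombination
        (solution-combination _ L (x - α) (- (b * b)) (solution-suc L L-solution) L-solution)
        pathCombination-solution base₀ base₁ k))
    where
    expansion : ℕ → Carrier
    expansion k = (x - α) * L (suc k) + - (b * b) * L k
    L-1 : L 1 ≈ x - α
    L-1 = detℕ-1 (tri (endDiagonal 1))
    base₀ : expansion 0 ≈ pathCombination 0
    base₀ = begin
      (x - α) * L 1 + - (b * b) * 1#    ≈⟨ +-congʳ (*-congˡ L-1) ⟩
      (x - α) * (x - α) + - (b * b) * 1#
        ≈⟨ solve 2 (λ x a → (x :- a) :* (x :- a) :+ :- (bₚ a :* bₚ a) :* 1ₚ
                         := x :* eₚ x a :+ ((a :+ a) :- 1ₚ) :* 1ₚ) refl x α ⟩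
      x * e + ((α + α) - 1#) * 1#       ≈⟨ +-congʳ (*-congˡ E-1) ⟨
      pathCombination 0 ∎
    base₁ : expansion 1 ≈ pathCombination 1
    base₁ = begin
      (x - α) * L 2 + - (b * b) * L 1
        ≈⟨ +-cong (*-congˡ (trans (L-solution 0) (+-congʳ (*-congˡ L-1)))) (*-congˡ L-1) ⟩
      (x - α) * (e * (x - α) - b * b * 1#) + - (b * b) * (x - α)
        ≈⟨ solve 2 (λ x a → (x :- a) :* (eₚ x a :* (x :- a) :- bₚ a :* bₚ a :* 1ₚ)
                              :+ :- (bₚ a :* bₚ a) :* (x :- a)
                         := x :* (eₚ x a :* eₚ x a :- bₚ a :* bₚ a :* 1ₚ)
                              :+ ((a :+ a) :- 1ₚ) :* eₚ x a) refl x α ⟩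
      x * (e * e - b * b * 1#) + ((α + α) - 1#) * e
        ≈⟨ +-cong (*-congˡ E-2) (*-congˡ E-1) ⟨
      pathCombination 1 ∎

  [1-α]²≈b*b : pow (1# - α) 2 ≈ b * b
  [1-α]²≈b*b = solve 1 (λ a → (1ₚ :- a) :* ((1ₚ :- a) :* 1ₚ) := bₚ a :* bₚ a) refl α

  phiP-recurrence : ∀ u → u * (1# - α) ≈ 1# → ∀ k →
    phiP α u x (suc (suc k)) ≈ e * phiP α u x (suc k) - pow (1# - α) 2 * phiP α u x k
  phiP-recurrence u u*[1-α]≈1 zero = begin
    phiP α u x 2                          ≈⟨ phiP≈pathCombination {u} 0 ⟩
    x * E 1 + ((α + α) - 1#) * 1#         ≈⟨ +-congʳ (*-congˡ E-1) ⟩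
    x * e + ((α + α) - 1#) * 1#
      ≈⟨ solve 2 (λ x a → x :* eₚ x a :+ ((a :+ a) :- 1ₚ) :* 1ₚ
                       := eₚ x a :* x :- (1ₚ :- (a :+ a)) :* (1ₚ :* 1ₚ)) refl x α ⟩
    e * x - (1# - (α + α)) * (1# * 1#)    ≈⟨ +-cong (*-congˡ (phiP-1 {u})) (-‿cong φP₀-term) ⟨
    e * phiP α u x 1 - pow (1# - α) 2 * phiP α u x 0 ∎
    where
    -- u inverts 1 - α, cancelling the u² in the convention φ(P₀) = (1 - 2α)u².
    φP₀-term : pow (1# - α) 2 * ((1# - (α + α)) * (u * u)) ≈ (1# - (α + α)) * (1# * 1#)
    φP₀-term = trans
      (solve 2 (λ a u → ((1ₚ :- a) :* ((1ₚ :- a) :* 1ₚ)) :* ((1ₚ :- (a :+ a)) :* (u :* u))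
                     := (1ₚ :- (a :+ a)) :* ((u :* (1ₚ :- a)) :* (u :* (1ₚ :- a)))) refl α u)
      (*-congˡ (*-cong u*[1-α]≈1 u*[1-α]≈1))
  phiP-recurrence u _ (suc zero) = begin
    phiP α u x 3                          ≈⟨ phiP≈pathCombination {u} 1 ⟩
    x * E 2 + ((α + α) - 1#) * E 1        ≈⟨ +-cong (*-congˡ E-2) (*-congˡ E-1) ⟩
    x * (e * e - b * b * 1#) + ((α + α) - 1#) * e
      ≈⟨ solve 2 (λ x a → x :* (eₚ x a :* eₚ x a :- bₚ a :* bₚ a :* 1ₚ)
                            :+ ((a :+ a) :- 1ₚ) :* eₚ x a
                       := eₚ x a :* (x :* eₚ x a :+ ((a :+ a) :- 1ₚ) :* 1ₚ)
                            :- (1ₚ :- a) :* ((1ₚ :- a) :* 1ₚ) :* x) refl x α ⟩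
    e * (x * e + ((α + α) - 1#) * 1#) - pow (1# - α) 2 * x
      ≈⟨ +-cong (*-congˡ (trans (phiP≈pathCombination {u} 0) (+-congʳ (*-congˡ E-1)))) (-‿cong (*-congˡ (phiP-1 {u}))) ⟨
    e * phiP α u x 2 - pow (1# - α) 2 * phiP α u x 1 ∎
  phiP-recurrence u _ (suc (suc k)) = begin
    phiP α u x (4 ℕ.+ k)                                   ≈⟨ phiP≈pathCombination {u} (2 ℕ.+ k) ⟩
    pathCombination (2 ℕ.+ k)                              ≈⟨ pathCombination-solution k ⟩
    e * pathCombination (1 ℕ.+ k) - b * b * pathCombination k
      ≈⟨ +-cong (*-congˡ (phiP≈pathCombination {u} (1 ℕ.+ k))) (-‿cong (*-cong [1-α]²≈b*b (phiP≈pathCombination {u} k))) ⟨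
    e * phiP α u x (3 ℕ.+ k) - pow (1# - α) 2 * phiP α u x (2 ℕ.+ k) ∎

module CycleIdentity {c ℓ} (R : CommutativeRing c ℓ) (α x : CommutativeRing.Carrier R) (k : ℕ) where
  open CommutativeRing R hiding (zero)
  open AlphaMatrices R
  open IntegerCoefficientSolver R
  open Determinants R
  open CharacteristicMatrix R α x
  open Tridiagonal R b
  open import Relation.Binary.Reasoning.Setoid setoid

  m : ℕ
  m = suc (suc (suc k))

  E₂ E₁ s P : Carrier
  E₂ = E (suc (suc k))
  E₁ = E (suc k)
  s = sgn (suc k)
  P = pow b (suc k)

  -- Row 0 of C is (e, b, 0, …, 0, b); below it sits T, preceded by the column (b, 0, …, 0, b)ᵀ.
  C : Matℕ
  C = charEntry (cycleAdjℕ m) (cycleDegree m)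

  T : Matℕ
  T = tri (λ _ → e)

  C-below : ∀ I K → I < suc (suc k) → C (suc I) (suc K) ≈ T I K
  C-below I K I<n = trans
    (charEntry-tri (λ I J → cycleAdjℕ m (suc I) (suc J)) (λ I J → ∨-identityʳ (pathAdjℕ I J)) (λ K → cycleDegree m (suc K)) I K)
    (tri-cong (suc (suc k)) (λ I I<n → diagonal-degree₂ (cycleDegree≡2 k (s≤s I<n))) I K I<n)

  firstColumn : ℕ → Carrier
  firstColumn I = unitColumn 0 b I + unitColumn (suc k) b I

  C-firstColumn : ∀ I → C (suc I) 0 ≈ firstColumn I
  C-firstColumn zero    = trans (entryOf-adjacent (cycleDegree m 1)) (sym (+-identityʳ b))
  C-firstColumn (suc I) = entry (I ≡ᵇ k)
    where
    entry : ∀ t → entryOf false false (cycleDegree m (suc (suc I))) (false ∨ t) ≈ 0# + (if t then b else 0#)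
    entry true  = trans (entryOf-adjacent (cycleDegree m (suc (suc I)))) (sym (+-identityˡ b))
    entry false = trans (entryOf-nonadjacent (cycleDegree m (suc (suc I)))) (sym (+-identityˡ 0#))

  C₀₀ : C 0 0 ≈ e
  C₀₀ = trans (entryOf-diagonal (cycleDegree m 0)) (diagonal-degree₂ (cycleDegree≡2 k (s≤s z≤n)))

  C₀-inner : ∀ J → J < k → C 0 (suc (suc J)) ≈ 0#
  C₀-inner J J<k = entry (J ≡ᵇ k) (<⇒≡ᵇ-false J<k)
    where
    entry : ∀ t → t ≡ false → entryOf false false (cycleDegree m 0) (t ∨ false) ≈ 0#
    entry .false ≡.refl = entryOf-nonadjacent (cycleDegree m 0)

  C₀-last : C 0 (suc (suc k)) ≈ b
  C₀-last = entry (k ≡ᵇ k) (≡ᵇ-refl k)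
    where
    entry : ∀ t → t ≡ true → entryOf false false (cycleDegree m 0) (t ∨ false) ≈ b
    entry .true ≡.refl = entryOf-adjacent (cycleDegree m 0)

  minor₀ : detℕ (suc (suc k)) (minor 0 C) ≈ E₂
  minor₀ = detℕ-cong (suc (suc k)) _ _ (λ I K I<n _ → C-below I K I<n)

  minor₁ : detℕ (suc (suc k)) (minor 1 C) ≈ b * E₁ + s * (b * P)
  minor₁ = begin
    detℕ (suc (suc k)) (minor 1 C)                 ≈⟨ detℕ-cong (suc (suc k)) _ _ entry ⟩
    detℕ (suc (suc k)) (consColumn firstColumn B)  ≈⟨ detℕ-firstColumn-top+bottom (suc k) b B ⟩
    b * E₁ + s * (b * detℕ (suc k) B)              ≈⟨ +-congˡ (*-congˡ (*-congˡ (detTri-dropFirstColumn (suc k) (λ _ → e)))) ⟩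
    b * E₁ + s * (b * P)                           ∎
    where
    B : Matℕ
    B I K = T I (suc K)
    entry : ∀ I K → I < suc (suc k) → K < suc (suc k) → minor 1 C I K ≈ consColumn firstColumn B I K
    entry I zero    _   _ = C-firstColumn I
    entry I (suc K) I<n _ = C-below I (suc K) I<n

  minor-last : detℕ (suc (suc k)) (minor (suc (suc k)) C) ≈ b * P + s * (b * E₁)
  minor-last = begin
    detℕ (suc (suc k)) (minor (suc (suc k)) C)              ≈⟨ detℕ-cong (suc (suc k)) _ _ entry ⟩
    detℕ (suc (suc k)) (consColumn firstColumn T)           ≈⟨ detℕ-firstColumn-top+bottom (suc k) b T ⟩
    b * detℕ (suc k) (λ I K → T (suc I) K) + s * (b * E₁)  ≈⟨ +-congʳ (*-congˡ (detTri-dropFirstRow (suc k) (λ _ → e))) ⟩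
    b * P + s * (b * E₁)                                    ∎
    where
    entry : ∀ I K → I < suc (suc k) → K < suc (suc k) → minor (suc (suc k)) C I K ≈ consColumn firstColumn T I K
    entry I zero    _   _         = C-firstColumn I
    entry I (suc K) I<n (s≤s K<n) =
      trans (reflexive (≡.cong (λ K′ → C (suc I) (suc K′)) (punchInℕ-< K<n))) (C-below I K I<n)

  expansionTerm : ℕ → Carrier
  expansionTerm J = sgn J * (C 0 J * detℕ (suc (suc k)) (minor J C))

  phiC-expand : phiC α x m ≈ e * E₂ - b * (b * E₁ + s * (b * P)) + sgn (suc (suc k)) * (b * (b * P + s * (b * E₁)))
  phiC-expand = begin
    phiC α x m
      ≈⟨ charPoly-Aα m (cycleAdjℕ m) ⟩
    detℕ m C
      ≈⟨ detℕ-expand (suc (suc k)) C ⟩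
    expansionTerm 0 + (expansionTerm 1 + sumℕ (suc k) (λ J → expansionTerm (suc (suc J))))
      ≈⟨ +-congˡ (+-congˡ (sumℕ-last k (λ J → expansionTerm (suc (suc J))))) ⟩
    expansionTerm 0 + (expansionTerm 1 + (sumℕ k (λ J → expansionTerm (suc (suc J))) + expansionTerm (suc (suc k))))
      ≈⟨ +-cong (*-congˡ (*-cong C₀₀ minor₀))
                (+-cong (*-congˡ (*-cong (entryOf-adjacent (cycleDegree m 0)) minor₁))
                        (+-cong (sumℕ-zero k (λ J J<k → trans (*-congˡ (*-congʳ (C₀-inner J J<k))) (s*[0*d]≈0 _ _)))
                                (*-congˡ (*-cong C₀-last minor-last)))) ⟩
    1# * (e * E₂) + ((- 1# * 1#) * (b * (b * E₁ + s * (b * P))) + (0# + (- 1# * s) * (b * (b * P + s * (b * E₁)))))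
      ≈⟨ solve 6 (λ e b E₂ E₁ s P →
           1ₚ :* (e :* E₂) :+ ((:- 1ₚ :* 1ₚ) :* (b :* (b :* E₁ :+ s :* (b :* P)))
             :+ (0ₚ :+ (:- 1ₚ :* s) :* (b :* (b :* P :+ s :* (b :* E₁)))))
           := e :* E₂ :- b :* (b :* E₁ :+ s :* (b :* P)) :+ (:- 1ₚ :* s) :* (b :* (b :* P :+ s :* (b :* E₁)))) refl e b E₂ E₁ s P ⟩
    e * E₂ - b * (b * E₁ + s * (b * P)) + sgn (suc (suc k)) * (b * (b * P + s * (b * E₁))) ∎

  phiC-formula : phiC α x m ≈ e * E₂ - (1# + 1#) * (pow b 2 * E₁) + (1# + 1#) * (sgn (suc (suc k)) * pow b m)
  phiC-formula = begin
    phiC α x m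
      ≈⟨ phiC-expand ⟩
    e * E₂ - b * (b * E₁ + s * (b * P)) + (- 1# * s) * (b * (b * P + s * (b * E₁)))
      ≈⟨ solve 6 (λ e b E₂ E₁ s P →
           e :* E₂ :- b :* (b :* E₁ :+ s :* (b :* P)) :+ (:- 1ₚ :* s) :* (b :* (b :* P :+ s :* (b :* E₁)))
           := e :* E₂ :- (1ₚ :+ 1ₚ) :* ((b :* (b :* 1ₚ)) :* E₁)
              :+ (1ₚ :+ 1ₚ) :* ((:- 1ₚ :* s) :* (b :* (b :* P)))
              :+ (1ₚ :- s :* s) :* (b :* b :* E₁)) refl e b E₂ E₁ s P ⟩
    e * E₂ - (1# + 1#) * (pow b 2 * E₁) + (1# + 1#) * (sgn (suc (suc k)) * pow b m) + (1# - s * s) * (b * b * E₁)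
      ≈⟨ +-congˡ (*-congʳ (trans (+-congˡ (-‿cong (sgn²≈1 (suc k)))) (-‿inverseʳ 1#))) ⟩
    e * E₂ - (1# + 1#) * (pow b 2 * E₁) + (1# + 1#) * (sgn (suc (suc k)) * pow b m) + 0# * (b * b * E₁)
      ≈⟨ trans (+-congˡ (zeroˡ _)) (+-identityʳ _) ⟩
    e * E₂ - (1# + 1#) * (pow b 2 * E₁) + (1# + 1#) * (sgn (suc (suc k)) * pow b m) ∎

mainTheorem6 : ∀ {c ℓ} (R : CommutativeRing c ℓ) →
    let open CommutativeRing R in
    let open AlphaMatrices R in
    (α u x : Carrier) → u * (1# - α) ≈ 1# → (k : ℕ) →
      (phiP α u x (suc (suc k))
         ≈ (x - (α + α)) * phiP α u x (suc k) - pow (1# - α) 2 * phiP α u x k)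
      × (phiP α u x (suc (suc k))
         ≈ x * phiH α x (suc k) + ((α + α) - 1#) * phiH α x k)
      × (phiC α x (suc (suc (suc k)))
         ≈ (x - (α + α)) * phiH α x (suc (suc k)) - (1# + 1#) * (pow (α - 1#) 2 * phiH α x (suc k))
           + (1# + 1#) * (sgn (suc (suc k)) * pow (α - 1#) (suc (suc (suc k)))))
mainTheorem6 R α u x u*[1-α]≈1 k =
    phiP-recurrence u u*[1-α]≈1 k
  , trans (phiP≈pathCombination {u} k) (sym (+-cong (*-congˡ (phiH≈E (suc k))) (*-congˡ (phiH≈E k))))
  , trans phiC-formula (sym (+-congʳ (+-cong (*-congˡ (phiH≈E (suc (suc k)))) (-‿cong (*-congˡ (*-congˡ (phiH≈E (suc k))))))))
  where
  open CommutativeRing R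
  open CharacteristicMatrix R α x using (phiH≈E)
  open PathIdentities R α x using (phiP-recurrence; phiP≈pathCombination)
  open CycleIdentity R α x k using (phiC-formula)
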